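{- Let $G=(V,E)$ be a finite connected loopless graph. An element $\beta\in F_\mathbb{Z}$ is a generalized cut element if and only if $\|\beta\|_\infty\le 1$.
   Context: $\mathbb{E}$: oriented edges of $G$; $C^1(G,\mathbb{Z})$: functions $x\colon\mathbb{E}\to\mathbb{Z}$ with $x_{\bar e}=-x_e$; $d(f)(uv)=f(v)-f(u)$ for $f\colon V\to\mathbb{Z}$; $F_\mathbb{Z}=d(C^0(G,\mathbb{Z}))$; $\|x\|_\infty=\max_{e\in\mathbb{E}}|x_e|$. A generalized cut $\mathfrak{C}$ of $G$ is an ordered partition of $V$ into sets $V_1,\dots,V_s$, $s\ge2$, such that there is no edge between $V_i$ and $V_j$ when $|i-j|\ge2$. Its characteristic function $\chi_\mathfrak{C}\colon V\to\mathbb{Z}$ takes value $i$ on $V_i$. A generalized cut element is an element of $F_\mathbb{Z}$ of the form $d(\chi_\mathfrak{C})$ for a generalized cut $\mathfrak{C}$. -}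

module Defs where

open import Data.Nat using (ℕ; suc; _≥_; _≤_) renaming (∣_-_∣ to dist)
open import Data.Sum using (_⊎_)
open import Data.Integer using (-_)
open import Data.Fin using (Fin; toℕ)
open import Data.Bool using (Bool; true; false; not)
open import Data.Integer using (ℤ; +_; _-_; ∣_∣)
open import Data.Product using (_×_; _,_; proj₁; proj₂; Σ; ∃)
open import Relation.Binary.PropositionalEquality using (_≡_; _≢_)
open import Relation.Nullary using (¬_)

record Graph : Set where
  field
    n    : ℕ
    m    : ℕ
    ends : Fin m → Fin n × Fin n

open Graph public

Loopless : Graph → Set
Loopless G = ∀ k → proj₁ (ends G k) ≢ proj₂ (ends G k)

Adj : (G : Graph) → Fin (n G) → Fin (n G) → Set
Adj G u v = ∃ λ k → (ends G k ≡ (u , v)) ⊎ (ends G k ≡ (v , u))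

data Reach (G : Graph) : Fin (n G) → Fin (n G) → Set where
  here : ∀ {u} → Reach G u u
  step : ∀ {u v w} → Adj G u v → Reach G v w → Reach G u w

Connected : Graph → Set
Connected G = ∀ u v → Reach G u v

-- oriented edges: (k , true) is edge k oriented as ends k, (k , false) the reverse
OEdge : Graph → Set
OEdge G = Fin (m G) × Bool

rev : {G : Graph} → OEdge G → OEdge G
rev (k , b) = (k , not b)

tail head : (G : Graph) → OEdge G → Fin (n G)
tail G (k , true)  = proj₁ (ends G k)
tail G (k , false) = proj₂ (ends G k)
head G (k , true)  = proj₂ (ends G k)
head G (k , false) = proj₁ (ends G k)

record C1 (G : Graph) : Set where
  field
    val  : OEdge G → ℤ
    anti : ∀ e → val (rev {G} e) ≡ - (val e)

open C1 public

d : (G : Graph) → (Fin (n G) → ℤ) → OEdge G → ℤ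
d G f e = f (head G e) - f (tail G e)

-- membership in F_ℤ = d(C^0(G, ℤ))
InFZ : (G : Graph) → C1 G → Set
InFZ G x = Σ (Fin (n G) → ℤ) λ f → ∀ e → val x e ≡ d G f e

SupNormLe1 : (G : Graph) → C1 G → Set
SupNormLe1 G x = ∀ e → ∣ val x e ∣ ≤ 1

-- A generalized cut: ordered partition V_1, …, V_s (s ≥ 2) of V, given by
-- the map part : V → Fin s (vertex v lies in V_{toℕ (part v) + 1}),
-- with no edge between V_i and V_j when |i - j| ≥ 2.
record GenCut (G : Graph) : Set where
  field
    s       : ℕ
    s≥2     : s ≥ 2
    part    : Fin (n G) → Fin s
    noLong  : ∀ k → ¬ (dist (toℕ (part (proj₁ (ends G k)))) (toℕ (part (proj₂ (ends G k)))) ≥ 2)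

open GenCut public

χ : {G : Graph} → GenCut G → Fin (n G) → ℤ
χ c v = + suc (toℕ (part c v))

IsGenCutElement : (G : Graph) → C1 G → Set
IsGenCutElement G x = Σ (GenCut G) λ c → ∀ e → val x e ≡ d G (χ c) e

-- A cut element d(χ) has |β| ≤ 1 because the parts of adjacent vertices have
-- indices differing by at most one. Conversely, if β = d f with ‖β‖∞ ≤ 1, shift f
-- by a constant into {1, …, s}: its level sets form a generalized cut whose
-- characteristic function is f up to a constant, and |β| ≤ 1 on every edge is
-- exactly the condition that no edge jumps two levels.
module Submission where

open import Defs
open import Data.Product using (_×_)
open import Function.Bundles using (_⇔_)

open import Data.Bool using (true; false)
open import Data.Fin using (Fin; toℕ; fromℕ<) renaming (zero to fzero; suc to fsuc)
open import Data.Fin.Properties using (toℕ-fromℕ<)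
open import Data.Integer as ℤ using (ℤ; +_; -[1+_]; ∣_∣; _-_)
import Data.Integer.Properties as ℤ
open import Data.Integer.Tactic.RingSolver using (solve-∀)
open import Data.Nat as ℕ using (ℕ; zero; suc; _≤_; s≤s) renaming (∣_-_∣ to dist)
import Data.Nat.Properties as ℕ
open import Data.Product using (_,_; proj₁; proj₂; ∃)
open import Function.Bundles using (mk⇔)
open import Relation.Binary.PropositionalEquality using (_≡_; refl; sym; trans; cong; cong₂; subst; module ≡-Reasoning)

∣+m-+n∣≡dist : ∀ m n → ∣ + m - + n ∣ ≡ dist m n
∣+m-+n∣≡dist zero    zero    = refl
∣+m-+n∣≡dist zero    (suc n) = refl
∣+m-+n∣≡dist (suc m) zero    = cong suc (ℕ.+-identityʳ m)
∣+m-+n∣≡dist (suc m) (suc n) = begin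
  ∣ suc m ℤ.⊖ suc n ∣ ≡⟨ cong ∣_∣ (ℤ.[1+m]⊖[1+n]≡m⊖n m n) ⟩
  ∣ m ℤ.⊖ n ∣         ≡⟨ cong ∣_∣ (ℤ.m-n≡m⊖n m n) ⟨
  ∣ + m - + n ∣       ≡⟨ ∣+m-+n∣≡dist m n ⟩
  dist m n            ∎
  where open ≡-Reasoning

[i+k]-[j+k]≡i-j : ∀ i j k → (i ℤ.+ k) - (j ℤ.+ k) ≡ i - j
[i+k]-[j+k]≡i-j = solve-∀

∃-bound : ∀ {n} (f : Fin n → ℤ) → ∃ λ B → ∀ v → ∣ f v ∣ ≤ B
∃-bound {zero}  f = 0 , λ ()
∃-bound {suc n} f with ∃-bound (λ v → f (fsuc v))
... | B , ∣f∣≤B = ∣ f fzero ∣ ℕ.⊔ B , λ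
  { fzero    → ℕ.m≤m⊔n ∣ f fzero ∣ B
  ; (fsuc v) → ℕ.m≤n⇒m≤o⊔n ∣ f fzero ∣ (∣f∣≤B v) }

shift-into-range : ∀ {B} x → ∣ x ∣ ≤ B → ∃ λ k → k ≤ B ℕ.+ B × + k ≡ x ℤ.+ + B
shift-into-range {B} (+ a)    a≤B   = a ℕ.+ B , ℕ.+-monoˡ-≤ B a≤B , refl
shift-into-range {B} -[1+ a ] 1+a≤B =
  B ℕ.∸ suc a , ℕ.≤-trans (ℕ.m∸n≤m B (suc a)) (ℕ.m≤m+n B B) , sym (ℤ.⊖-≥ 1+a≤B)

record Levelling {n} (f : Fin n → ℤ) : Set where
  field
    s      : ℕ
    s≥2    : s ℕ.≥ 2
    level  : Fin n → Fin s
    offset : ℤ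
    rank≡  : ∀ v → + suc (toℕ (level v)) ≡ f v ℤ.+ offset

open Levelling

levelling : ∀ {n} (f : Fin n → ℤ) → Levelling f
levelling {n} f = record
  { s      = 2 ℕ.+ (B ℕ.+ B)
  ; s≥2    = ℕ.m≤m+n 2 (B ℕ.+ B)
  ; level  = level′
  ; offset = + B ℤ.+ + 1
  ; rank≡  = rank≡′
  }
  where
  B : ℕ
  B = proj₁ (∃-bound f)
  shifted : ∀ v → ∃ λ k → k ≤ B ℕ.+ B × + k ≡ f v ℤ.+ + B
  shifted v = shift-into-range (f v) (proj₂ (∃-bound f) v)
  level′ : Fin n → Fin (2 ℕ.+ (B ℕ.+ B))
  level′ v = fromℕ< (s≤s (ℕ.m≤n⇒m≤1+n (proj₁ (proj₂ (shifted v)))))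
  rank≡′ : ∀ v → + suc (toℕ (level′ v)) ≡ f v ℤ.+ (+ B ℤ.+ + 1)
  rank≡′ v = begin
    + suc (toℕ (level′ v))   ≡⟨ cong (λ k → + suc k) (toℕ-fromℕ< _) ⟩
    + suc k                  ≡⟨ cong +_ (ℕ.+-comm 1 k) ⟩
    + k ℤ.+ + 1              ≡⟨ cong (ℤ._+ + 1) (proj₂ (proj₂ (shifted v))) ⟩
    (f v ℤ.+ + B) ℤ.+ + 1    ≡⟨ ℤ.+-assoc (f v) (+ B) (+ 1) ⟩
    f v ℤ.+ (+ B ℤ.+ + 1)    ∎
    where
    open ≡-Reasoning
    k = proj₁ (shifted v)

module _ (G : Graph) where

  ∣d∣-orientation : ∀ g k b → ∣ d G g (k , b) ∣ ≡ ∣ d G g (k , true) ∣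
  ∣d∣-orientation g k true  = refl
  ∣d∣-orientation g k false = ℤ.∣i-j∣≡∣j-i∣ (g (proj₁ (ends G k))) (g (proj₂ (ends G k)))

  d-translation-invariant : ∀ g h c → (∀ v → g v ≡ h v ℤ.+ c) → ∀ e → d G g e ≡ d G h e
  d-translation-invariant g h c g≡h+c e = begin
    g (head G e) - g (tail G e)                       ≡⟨ cong₂ _-_ (g≡h+c (head G e)) (g≡h+c (tail G e)) ⟩
    (h (head G e) ℤ.+ c) - (h (tail G e) ℤ.+ c)       ≡⟨ [i+k]-[j+k]≡i-j (h (head G e)) (h (tail G e)) c ⟩
    h (head G e) - h (tail G e)                       ∎
    where open ≡-Reasoning

  rank : ∀ {s} → (Fin (n G) → Fin s) → Fin (n G) → ℤ
  rank p v = + suc (toℕ (p v))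

  gap : ∀ {s} → (Fin (n G) → Fin s) → Fin (m G) → ℕ
  gap p k = dist (toℕ (p (proj₁ (ends G k)))) (toℕ (p (proj₂ (ends G k))))

  ∣d-rank∣≡gap : ∀ {s} (p : Fin (n G) → Fin s) k → ∣ d G (rank p) (k , true) ∣ ≡ gap p k
  ∣d-rank∣≡gap p k = begin
    ∣ rank p w - rank p u ∣ ≡⟨ ∣+m-+n∣≡dist (suc (toℕ (p w))) (suc (toℕ (p u))) ⟩
    dist (toℕ (p w)) (toℕ (p u)) ≡⟨ ℕ.∣-∣-comm (toℕ (p w)) (toℕ (p u)) ⟩
    dist (toℕ (p u)) (toℕ (p w)) ∎
    where
    open ≡-Reasoning
    u = proj₁ (ends G k)
    w = proj₂ (ends G k)

  ∣d-χ∣≤1 : (c : GenCut G) → ∀ e → ∣ d G (χ c) e ∣ ≤ 1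
  ∣d-χ∣≤1 c (k , b) = begin
    ∣ d G (χ c) (k , b) ∣    ≡⟨ ∣d∣-orientation (χ c) k b ⟩
    ∣ d G (χ c) (k , true) ∣ ≡⟨ ∣d-rank∣≡gap (part c) k ⟩
    gap (part c) k           ≤⟨ ℕ.≮⇒≥ (noLong c k) ⟩
    1                        ∎
    where open ℕ.≤-Reasoning

  levellingCut : ∀ {f} → Levelling f → (∀ k → ∣ d G f (k , true) ∣ ≤ 1) → GenCut G
  levellingCut {f} L ∣df∣≤1 = record
    { s = s L ; s≥2 = s≥2 L ; part = level L ; noLong = λ k → ℕ.≤⇒≯ (gap≤1 k) }
    where
    gap≤1 : ∀ k → gap (level L) k ≤ 1
    gap≤1 k = begin
      gap (level L) k                      ≡⟨ ∣d-rank∣≡gap (level L) k ⟨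
      ∣ d G (rank (level L)) (k , true) ∣ ≡⟨ cong ∣_∣ (d-translation-invariant _ f (offset L) (rank≡ L) (k , true)) ⟩
      ∣ d G f (k , true) ∣                ≤⟨ ∣df∣≤1 k ⟩
      1                                    ∎
      where open ℕ.≤-Reasoning

  d-χ-levellingCut : ∀ {f} (L : Levelling f) ∣df∣≤1 e → d G (χ (levellingCut L ∣df∣≤1)) e ≡ d G f e
  d-χ-levellingCut {f} L _ = d-translation-invariant _ f (offset L) (rank≡ L)

proposition3p24 : (G : Graph) → Loopless G → Connected G →
    (β : C1 G) → InFZ G β →
    IsGenCutElement G β ⇔ SupNormLe1 G β
proposition3p24 G _ _ β (f , β≡df) = mk⇔ cut⇒bounded bounded⇒cut
  where
  cut⇒bounded : IsGenCutElement G β → SupNormLe1 G β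
  cut⇒bounded (c , β≡dχ) e = subst (_≤ 1) (cong ∣_∣ (sym (β≡dχ e))) (∣d-χ∣≤1 G c e)

  bounded⇒cut : SupNormLe1 G β → IsGenCutElement G β
  bounded⇒cut ∣β∣≤1 = levellingCut G L ∣df∣≤1 , λ e → trans (β≡df e) (sym (d-χ-levellingCut G L ∣df∣≤1 e))
    where
    L : Levelling f
    L = levelling f
    ∣df∣≤1 : ∀ k → ∣ d G f (k , true) ∣ ≤ 1
    ∣df∣≤1 k = subst (_≤ 1) (cong ∣_∣ (β≡df (k , true))) (∣β∣≤1 (k , true))
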